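{- Let $k\ge1$ be an integer. If $n\ge 2k+4$, then the complete graph $K_n$ is $k$-canceling.
   Context: A signing of a graph $G$ is a map $\sigma:E(G)\to\{\pm1\}$; for a path $P$, $\sigma(P)=\sum_{e\in P}\sigma(e)$. In a graph $H$, $d_\sigma(u,v)=\min_P|\sigma(P)|$ over all $uv$-paths $P$ in $H$ ($\infty$ if none, $0$ if $u=v$), and $W_\sigma(H)=\frac12\sum_{u,v\in V(H)}d_\sigma(u,v)$. $G$ is $k$-canceling if there is a signing $\sigma$ such that $W_\sigma(G-S)=0$ for every $S\subseteq V(G)$ with $|S|<k$ (with $\sigma$ restricted to $G-S$ and distances computed in $G-S$). -}

module Defs where

open import Data.Nat using (ℕ; zero; suc; _+_; _<_; _≤_; _⊔_; _⊓_; _/_)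
open import Data.Integer as ℤ using (ℤ)
open import Data.Sign using (Sign)
open import Data.Bool using (Bool; true; false; not; _∧_; if_then_else_)
open import Data.Fin using (Fin; _≟_)
open import Data.Fin.Subset using (Subset; ∣_∣)
open import Data.Vec using (lookup)
open import Data.List using (List; []; _∷_; _++_; map; concatMap; filter; foldr; allFin; upTo)
open import Data.Maybe using (Maybe; just; nothing)
open import Relation.Nullary.Decidable using (⌊_⌋; does)
open import Relation.Binary.PropositionalEquality using (_≡_; refl; cong; sym)
open import Relation.Nullary using (yes; no)
open import Data.Empty using (⊥-elim)
open import Data.Product using (Σ; _×_; _,_)

record Graph : Set where
  field
    size    : ℕ
    adj     : Fin size → Fin size → Bool
    adj-sym : ∀ i j → adj i j ≡ adj j i
    adj-irr : ∀ i → adj i i ≡ false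
open Graph public

eqᵇ : ∀ {n} → Fin n → Fin n → Bool
eqᵇ i j = does (i ≟ j)

eqᵇ-sym : ∀ {n} (i j : Fin n) → eqᵇ i j ≡ eqᵇ j i
eqᵇ-sym i j with i ≟ j | j ≟ i
... | yes _ | yes _ = refl
... | no _  | no _  = refl
... | yes p | no q  = ⊥-elim (q (sym p))
... | no q  | yes p = ⊥-elim (q (sym p))

eqᵇ-refl : ∀ {n} (i : Fin n) → eqᵇ i i ≡ true
eqᵇ-refl i with i ≟ i
... | yes _ = refl
... | no q  = ⊥-elim (q refl)

K : ℕ → Graph
K n = record
  { size    = n
  ; adj     = λ i j → not (eqᵇ i j)
  ; adj-sym = λ i j → cong not (eqᵇ-sym i j)
  ; adj-irr = λ i → cong not (eqᵇ-refl i) }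

-- Signings: a sign on every edge.  Represented by a function on ordered
-- pairs that is symmetric on edges (values on non-edges are irrelevant).

IsSigning : (G : Graph) → (Fin (size G) → Fin (size G) → Sign) → Set
IsSigning G σ = ∀ i j → adj G i j ≡ true → σ i j ≡ σ j i

signValue : Sign → ℤ
signValue Sign.+ = ℤ.+ 1
signValue Sign.- = ℤ.- (ℤ.+ 1)

module _ (G : Graph) (σ : Fin (size G) → Fin (size G) → Sign)
         (S : Subset (size G)) where

  private
    n = size G
    V = Fin n

  present : V → Bool
  present v = not (lookup S v)

  pathSum : List V → ℤ
  pathSum (a ∷ b ∷ rest) = signValue (σ a b) ℤ.+ pathSum (b ∷ rest)
  pathSum _              = ℤ.+ 0

  notIn : V → List V → Bool
  notIn v []       = true
  notIn v (w ∷ ws) = not (eqᵇ v w) ∧ notIn v ws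

  distinct : List V → Bool
  distinct []       = true
  distinct (w ∷ ws) = notIn w ws ∧ distinct ws

  allPresent : List V → Bool
  allPresent []       = true
  allPresent (w ∷ ws) = present w ∧ allPresent ws

  consecAdj : List V → Bool
  consecAdj (a ∷ b ∷ rest) = adj G a b ∧ consecAdj (b ∷ rest)
  consecAdj _              = true

  lastOr : V → List V → V
  lastOr d []       = d
  lastOr d (w ∷ ws) = lastOr w ws

  isPath : V → V → List V → Bool
  isPath u v []       = false
  isPath u v (w ∷ ws) =
    eqᵇ w u ∧ eqᵇ (lastOr w ws) v ∧ distinct (w ∷ ws)
      ∧ allPresent (w ∷ ws) ∧ consecAdj (w ∷ ws)

  words : ℕ → List (List V)
  words zero    = [] ∷ []
  words (suc m) = concatMap (λ i → map (i ∷_) (words m)) (allFin n)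

  -- all words of length ≤ n (every path has at most n vertices)
  allWords : List (List V)
  allWords = concatMap words (upTo (suc n))

  -- ℕ ∪ {∞} as Maybe ℕ (nothing = ∞)
  minℕ∞ : Maybe ℕ → Maybe ℕ → Maybe ℕ
  minℕ∞ nothing  y        = y
  minℕ∞ x        nothing  = x
  minℕ∞ (just a) (just b) = just (a ⊓ b)

  addℕ∞ : Maybe ℕ → Maybe ℕ → Maybe ℕ
  addℕ∞ (just a) (just b) = just (a + b)
  addℕ∞ _        _        = nothing

  dist : V → V → Maybe ℕ
  dist u v = if eqᵇ u v then just 0 else
    foldr (λ P acc → if isPath u v P then minℕ∞ (just (ℤ.∣ pathSum P ∣)) acc else acc)
          nothing allWords

  doubleW : Maybe ℕ
  doubleW = foldr (λ u acc → if present u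
                      then foldr (λ v acc' → if present v then addℕ∞ (dist u v) acc' else acc')
                                 acc (allFin n)
                      else acc)
                  (just 0) (allFin n)

  wiener : Maybe ℕ
  wiener with doubleW
  ... | just m  = just (m / 2)
  ... | nothing = nothing

IsCanceling : ℕ → Graph → Set
IsCanceling k G =
  Σ (Fin (size G) → Fin (size G) → Sign) λ σ →
    IsSigning G σ ×
    (∀ (S : Subset (size G)) → ∣ S ∣ < k → wiener G σ S ≡ just 0)

-- Split the vertices of K_n alternately into two classes, each of size at
-- least k + 2, and sign an edge + inside a class and − across the classes.
-- Deleting fewer than k vertices leaves at least three vertices in each
-- class.  Two surviving vertices in different classes are joined through any
-- third one by a path with one edge of each sign; two vertices u, v of the
-- same class by a path u a b b′ v with a in their class and b, b′ in the
-- other, whose signs are +, −, +, −.  So every distance in K_n − S is 0.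
module Submission where

open import Defs
open import Data.Nat using (ℕ; _≤_; _+_; _*_)

open import Data.Nat using (zero; suc; _<_; s≤s; z≤n)
open import Data.Nat.Properties
  using (≤-trans; ≤-reflexive; n≤1+n; m≤m+n; +-suc; +-comm; +-monoˡ-≤; +-monoʳ-≤; ⊓-zeroʳ; module ≤-Reasoning)
open import Data.Nat.Solver using (module +-*-Solver)
open import Data.Bool using (Bool; true; false; not; _xor_; if_then_else_)
open import Data.Bool.Properties as Bool using (xor-comm; not-¬; ¬-not; not-injective)
open import Data.Fin using (Fin; zero; suc; _≟_)
open import Data.Fin.Subset using (Subset; inside; outside; _∈_; _∉_; _∪_; ∁; ⁅_⁆; ∣_∣)
open import Data.Fin.Subset.Properties using (x∈p∪q⁺; x∈⁅x⁆; ∣⁅x⁆∣≡1)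
open import Data.Vec using (lookup; []; _∷_; here; there)
open import Data.Vec.Properties using (lookup-map; []=⇒lookup; lookup⇒[]=)
open import Data.List using ([]; _∷_; length; foldr; allFin)
open import Data.List.Relation.Unary.All using (All; []; _∷_)
open import Data.List.Relation.Unary.AllPairs using (AllPairs; []; _∷_)
open import Data.List.Relation.Unary.Any using (here; there)
open import Data.List.Membership.Propositional using (lose) renaming (_∈_ to _∈ˡ_)
open import Data.List.Membership.Propositional.Properties using (∈-concatMap⁺; ∈-map⁺; ∈-allFin; ∈-upTo⁺)
open import Data.Maybe using (just; nothing)
open import Data.Product using (∃; _×_; _,_)
open import Data.Sum using (inj₁; inj₂)
open import Data.Sign using (Sign)
import Data.Integer as ℤ
open import Function using (_∘_; case_of_)
open import Relation.Binary.PropositionalEquality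
  using (_≡_; _≢_; refl; sym; trans; cong; cong₂; subst; ≢-sym)
open import Relation.Nullary using (yes; no; contradiction)

∣p∪q∣≤∣p∣+∣q∣ : ∀ {n} (p q : Subset n) → ∣ p ∪ q ∣ ≤ ∣ p ∣ + ∣ q ∣
∣p∪q∣≤∣p∣+∣q∣ []            []            = z≤n
∣p∪q∣≤∣p∣+∣q∣ (outside ∷ p) (outside ∷ q) = ∣p∪q∣≤∣p∣+∣q∣ p q
∣p∪q∣≤∣p∣+∣q∣ (inside  ∷ p) (outside ∷ q) = s≤s (∣p∪q∣≤∣p∣+∣q∣ p q)
∣p∪q∣≤∣p∣+∣q∣ (outside ∷ p) (inside  ∷ q) =
  ≤-trans (s≤s (∣p∪q∣≤∣p∣+∣q∣ p q)) (≤-reflexive (sym (+-suc ∣ p ∣ ∣ q ∣)))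
∣p∪q∣≤∣p∣+∣q∣ (inside  ∷ p) (inside  ∷ q) =
  s≤s (≤-trans (∣p∪q∣≤∣p∣+∣q∣ p q) (+-monoʳ-≤ ∣ p ∣ (n≤1+n ∣ q ∣)))

there-⊈ : ∀ {n s t} {p q : Subset n} →
          (∃ λ x → x ∈ p × x ∉ q) → ∃ λ x → x ∈ s ∷ p × x ∉ t ∷ q
there-⊈ (x , x∈p , x∉q) = suc x , there x∈p , λ { (there x∈q) → x∉q x∈q }

∣q∣<∣p∣⇒p⊈q : ∀ {n} (p q : Subset n) → ∣ q ∣ < ∣ p ∣ → ∃ λ x → x ∈ p × x ∉ q
∣q∣<∣p∣⇒p⊈q []            []            ()
∣q∣<∣p∣⇒p⊈q (inside  ∷ p) (outside ∷ q) _        = zero , here , λ ()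
∣q∣<∣p∣⇒p⊈q (inside  ∷ p) (inside  ∷ q) (s≤s lt) = there-⊈ (∣q∣<∣p∣⇒p⊈q p q lt)
∣q∣<∣p∣⇒p⊈q (outside ∷ p) (outside ∷ q) lt       = there-⊈ (∣q∣<∣p∣⇒p⊈q p q lt)
∣q∣<∣p∣⇒p⊈q (outside ∷ p) (inside  ∷ q) lt       =
  there-⊈ (∣q∣<∣p∣⇒p⊈q p q (≤-trans (n≤1+n _) lt))

∃-avoiding : ∀ {n} (D S : Subset n) (u v : Fin n) → 3 + ∣ S ∣ ≤ ∣ D ∣ →
             ∃ λ x → x ∈ D × x ∉ S × x ≢ u × x ≢ v
∃-avoiding D S u v large with ∣q∣<∣p∣⇒p⊈q D (S ∪ (⁅ u ⁆ ∪ ⁅ v ⁆)) (≤-trans (s≤s used) large)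
  where
  open ≤-Reasoning
  used : ∣ S ∪ (⁅ u ⁆ ∪ ⁅ v ⁆) ∣ ≤ 2 + ∣ S ∣
  used = begin
    ∣ S ∪ (⁅ u ⁆ ∪ ⁅ v ⁆) ∣       ≤⟨ ∣p∪q∣≤∣p∣+∣q∣ S _ ⟩
    ∣ S ∣ + ∣ ⁅ u ⁆ ∪ ⁅ v ⁆ ∣     ≤⟨ +-monoʳ-≤ ∣ S ∣ (∣p∪q∣≤∣p∣+∣q∣ ⁅ u ⁆ ⁅ v ⁆) ⟩
    ∣ S ∣ + (∣ ⁅ u ⁆ ∣ + ∣ ⁅ v ⁆ ∣) ≡⟨ cong (∣ S ∣ +_) (cong₂ _+_ (∣⁅x⁆∣≡1 u) (∣⁅x⁆∣≡1 v)) ⟩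
    ∣ S ∣ + 2                     ≡⟨ +-comm ∣ S ∣ 2 ⟩
    2 + ∣ S ∣                     ∎
... | x , x∈D , x∉used =
  x , x∈D , x∉used ∘ x∈p∪q⁺ ∘ inj₁
    , (λ { refl → x∉used (x∈p∪q⁺ (inj₂ (x∈p∪q⁺ (inj₁ (x∈⁅x⁆ x))))) })
    , (λ { refl → x∉used (x∈p∪q⁺ (inj₂ (x∈p∪q⁺ (inj₂ (x∈⁅x⁆ x))))) })

module _ (G : Graph) (σ : Fin (size G) → Fin (size G) → Sign) (S : Subset (size G)) where

  ∉⇒present : ∀ {x} → x ∉ S → present G σ S x ≡ true
  ∉⇒present {x} x∉S with lookup S x in S[x]
  ... | true  = contradiction (lookup⇒[]= x S S[x]) x∉S
  ... | false = refl

  present⇒∉ : ∀ {x} → present G σ S x ≡ true → x ∉ S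
  present⇒∉ x-present x∈S = contradiction (trans (sym (cong not ([]=⇒lookup x∈S))) x-present) λ ()

  ∈-words : ∀ xs → xs ∈ˡ words G σ S (length xs)
  ∈-words []       = here refl
  ∈-words (x ∷ xs) = ∈-concatMap⁺ _ (lose (∈-allFin x) (∈-map⁺ (x ∷_) (∈-words xs)))

  ∈-allWords : ∀ xs → length xs ≤ size G → xs ∈ˡ allWords G σ S
  ∈-allWords xs len = ∈-concatMap⁺ (words G σ S) (lose (∈-upTo⁺ (s≤s len)) (∈-words xs))

  dist-self : ∀ u → dist G σ S u u ≡ just 0
  dist-self u rewrite eqᵇ-refl u = refl

  minℕ∞-zeroˡ : ∀ y → minℕ∞ G σ S (just 0) y ≡ just 0
  minℕ∞-zeroˡ nothing  = refl
  minℕ∞-zeroˡ (just _) = refl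

  minℕ∞-zeroʳ : ∀ x → minℕ∞ G σ S x (just 0) ≡ just 0
  minℕ∞-zeroʳ nothing  = refl
  minℕ∞-zeroʳ (just m) = cong just (⊓-zeroʳ m)

  zeroSumPath⇒dist≡0 : ∀ {u v} P → length P ≤ size G → isPath G σ S u v P ≡ true →
                       ℤ.∣ pathSum G σ S P ∣ ≡ 0 → dist G σ S u v ≡ just 0
  zeroSumPath⇒dist≡0 {u} {v} P len P-path P-sum with eqᵇ u v
  ... | true  = refl
  ... | false = shortest (allWords G σ S) (∈-allWords P len)
    where
    shortest : ∀ Ps → P ∈ˡ Ps →
      foldr (λ Q acc → if isPath G σ S u v Q then minℕ∞ G σ S (just ℤ.∣ pathSum G σ S Q ∣) acc else acc)
            nothing Ps ≡ just 0
    shortest (Q ∷ Ps) (here refl) rewrite P-path | P-sum = minℕ∞-zeroˡ (foldr _ nothing Ps)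
    shortest (Q ∷ Ps) (there P∈Ps) rewrite shortest Ps P∈Ps with isPath G σ S u v Q
    ... | true  = minℕ∞-zeroʳ (just ℤ.∣ pathSum G σ S Q ∣)
    ... | false = refl

  dist≡0⇒wiener≡0 : (∀ u v → u ∉ S → v ∉ S → dist G σ S u v ≡ just 0) → wiener G σ S ≡ just 0
  dist≡0⇒wiener≡0 dist≡0 with doubleW G σ S | rowSums (allFin (size G))
    where
    row : ∀ u → u ∉ S → ∀ {acc} → acc ≡ just 0 → ∀ vs →
      foldr (λ v acc′ → if present G σ S v then addℕ∞ G σ S (dist G σ S u v) acc′ else acc′) acc vs ≡ just 0
    row u u∉S acc≡0 []       = acc≡0
    row u u∉S acc≡0 (v ∷ vs) with present G σ S v in v-present
    ... | true  rewrite dist≡0 u v u∉S (present⇒∉ v-present) | row u u∉S acc≡0 vs = refl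
    ... | false = row u u∉S acc≡0 vs

    rowSums : ∀ us →
      foldr (λ u acc → if present G σ S u
                         then foldr (λ v acc′ → if present G σ S v then addℕ∞ G σ S (dist G σ S u v) acc′ else acc′)
                                    acc (allFin (size G))
                         else acc)
            (just 0) us ≡ just 0
    rowSums []       = refl
    rowSums (u ∷ us) with present G σ S u in u-present
    ... | true  = row u (present⇒∉ u-present) (rowSums us) (allFin (size G))
    ... | false = rowSums us
  ... | .(just 0) | refl = refl

≢⇒eqᵇ≡false : ∀ {n} {x y : Fin n} → x ≢ y → eqᵇ x y ≡ false
≢⇒eqᵇ≡false {x = x} {y} x≢y with x ≟ y
... | yes x≡y = contradiction x≡y x≢y
... | no  _   = refl

module _ {n} (σ : Fin n → Fin n → Sign) (S : Subset n) where

  notIn-≢ : ∀ {x} ws → All (x ≢_) ws → notIn (K n) σ S x ws ≡ true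
  notIn-≢ []       []               = refl
  notIn-≢ (w ∷ ws) (x≢w ∷ x≢ws) rewrite ≢⇒eqᵇ≡false x≢w = notIn-≢ ws x≢ws

  distinct-AllPairs : ∀ ws → AllPairs _≢_ ws → distinct (K n) σ S ws ≡ true
  distinct-AllPairs []       []            = refl
  distinct-AllPairs (w ∷ ws) (w≢ws ∷ ws≢) rewrite notIn-≢ ws w≢ws = distinct-AllPairs ws ws≢

  allPresent-All : ∀ ws → All (_∉ S) ws → allPresent (K n) σ S ws ≡ true
  allPresent-All []       []            = refl
  allPresent-All (w ∷ ws) (w∉S ∷ ws∉S) rewrite ∉⇒present (K n) σ S w∉S = allPresent-All ws ws∉S

  consecAdj-AllPairs : ∀ ws → AllPairs _≢_ ws → consecAdj (K n) σ S ws ≡ true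
  consecAdj-AllPairs []            _                      = refl
  consecAdj-AllPairs (w ∷ [])      _                      = refl
  consecAdj-AllPairs (w ∷ w′ ∷ ws) ((w≢w′ ∷ _) ∷ w′ws≢) rewrite ≢⇒eqᵇ≡false w≢w′ =
    consecAdj-AllPairs (w′ ∷ ws) w′ws≢

  isPath-K : ∀ u v ws → lastOr (K n) σ S u ws ≡ v → AllPairs _≢_ (u ∷ ws) → All (_∉ S) (u ∷ ws) →
             isPath (K n) σ S u v (u ∷ ws) ≡ true
  isPath-K u v ws ends-at-v ≢ ∉S
    rewrite eqᵇ-refl u | ends-at-v | eqᵇ-refl v
          | distinct-AllPairs (u ∷ ws) ≢ | allPresent-All (u ∷ ws) ∉S | consecAdj-AllPairs (u ∷ ws) ≢ = refl

colourClass : ∀ {n} → Subset n → Bool → Subset n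
colourClass C true  = C
colourClass C false = ∁ C

lookup-colourClass : ∀ {n} (C : Subset n) b {x} → x ∈ colourClass C b → lookup C x ≡ b
lookup-colourClass C true      x∈C  = []=⇒lookup x∈C
lookup-colourClass C false {x} x∈∁C = not-injective (trans (sym (lookup-map x not C)) ([]=⇒lookup x∈∁C))

signingBy : ∀ {n} → Subset n → Fin n → Fin n → Sign
signingBy C i j = if lookup C i xor lookup C j then Sign.- else Sign.+

signingBy-sym : ∀ {n} (C : Subset n) i j → signingBy C i j ≡ signingBy C j i
signingBy-sym C i j = cong (λ b → if b then Sign.- else Sign.+) (xor-comm (lookup C i) (lookup C j))

module _ {n} (C S : Subset n) where

  private
    σ : Fin n → Fin n → Sign
    σ = signingBy C

  colour-≢ : ∀ {x y c} → lookup C x ≡ c → lookup C y ≡ not c → x ≢ y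
  colour-≢ cx cy refl = not-¬ cx cy

  crossPath-sum≡0 : ∀ u w v → lookup C v ≡ not (lookup C u) →
                    ℤ.∣ pathSum (K n) σ S (u ∷ w ∷ v ∷ []) ∣ ≡ 0
  crossPath-sum≡0 u w v cv rewrite cv with lookup C u | lookup C w
  ... | true  | true  = refl
  ... | true  | false = refl
  ... | false | true  = refl
  ... | false | false = refl

  samePath-sum≡0 : ∀ u a b b′ v → lookup C a ≡ lookup C u → lookup C v ≡ lookup C u →
                   lookup C b ≡ not (lookup C u) → lookup C b′ ≡ not (lookup C u) →
                   ℤ.∣ pathSum (K n) σ S (u ∷ a ∷ b ∷ b′ ∷ v ∷ []) ∣ ≡ 0
  samePath-sum≡0 u a b b′ v ca cv cb cb′ rewrite ca | cv | cb | cb′ with lookup C u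
  ... | true  = refl
  ... | false = refl

  module _ (n≥5 : 5 ≤ n) (large : ∀ c → 3 + ∣ S ∣ ≤ ∣ colourClass C c ∣) where

    crossColour-dist≡0 : ∀ {u v} → u ≢ v → lookup C v ≡ not (lookup C u) → u ∉ S → v ∉ S →
                         dist (K n) σ S u v ≡ just 0
    -- The middle vertex may have either colour: exactly one of its two edges crosses.
    crossColour-dist≡0 {u} {v} u≢v cv u∉S v∉S
      with w , _ , w∉S , w≢u , w≢v ← ∃-avoiding (colourClass C true) S u v (large true) =
      zeroSumPath⇒dist≡0 (K n) σ S (u ∷ w ∷ v ∷ []) (≤-trans (s≤s (s≤s (s≤s z≤n))) n≥5)
        (isPath-K σ S u v (w ∷ v ∷ []) refl
          ((≢-sym w≢u ∷ u≢v ∷ []) ∷ (w≢v ∷ []) ∷ [] ∷ [])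
          (u∉S ∷ w∉S ∷ v∉S ∷ []))
        (crossPath-sum≡0 u w v cv)

    sameColour-dist≡0 : ∀ {u v} → u ≢ v → lookup C v ≡ lookup C u → u ∉ S → v ∉ S →
                        dist (K n) σ S u v ≡ just 0
    sameColour-dist≡0 {u} {v} u≢v cv u∉S v∉S
      with a , a∈ , a∉S , a≢u , a≢v ← ∃-avoiding (colourClass C (lookup C u)) S u v (large (lookup C u))
         | b , b∈ , b∉S , _         ← ∃-avoiding (colourClass C (not (lookup C u))) S u v (large (not (lookup C u))) =
      through (∃-avoiding (colourClass C (not (lookup C u))) S b b (large (not (lookup C u))))
      where
      ca : lookup C a ≡ lookup C u
      ca = lookup-colourClass C _ a∈
      cb : lookup C b ≡ not (lookup C u)
      cb = lookup-colourClass C _ b∈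

      through : (∃ λ b′ → b′ ∈ colourClass C (not (lookup C u)) × b′ ∉ S × b′ ≢ b × b′ ≢ b) →
                dist (K n) σ S u v ≡ just 0
      through (b′ , b′∈ , b′∉S , b′≢b , _) =
        zeroSumPath⇒dist≡0 (K n) σ S (u ∷ a ∷ b ∷ b′ ∷ v ∷ []) n≥5
          (isPath-K σ S u v (a ∷ b ∷ b′ ∷ v ∷ []) refl
            ( (≢-sym a≢u ∷ colour-≢ refl cb ∷ colour-≢ refl cb′ ∷ u≢v ∷ [])
            ∷ (colour-≢ ca cb ∷ colour-≢ ca cb′ ∷ a≢v ∷ [])
            ∷ (≢-sym b′≢b ∷ ≢-sym (colour-≢ cv cb) ∷ [])
            ∷ (≢-sym (colour-≢ cv cb′) ∷ [])
            ∷ [] ∷ [])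
            (u∉S ∷ a∉S ∷ b∉S ∷ b′∉S ∷ v∉S ∷ []))
          (samePath-sum≡0 u a b b′ v ca cv cb cb′)
        where
        cb′ : lookup C b′ ≡ not (lookup C u)
        cb′ = lookup-colourClass C _ b′∈

    signingBy-dist≡0 : ∀ u v → u ∉ S → v ∉ S → dist (K n) σ S u v ≡ just 0
    signingBy-dist≡0 u v u∉S v∉S = case u ≟ v of λ where
      (yes u≡v) → subst (λ w → dist (K n) σ S u w ≡ just 0) u≡v (dist-self (K n) σ S u)
      (no u≢v)  → case Bool._≟_ (lookup C v) (lookup C u) of λ where
        (yes same) → sameColour-dist≡0 u≢v same u∉S v∉S
        (no cross) → crossColour-dist≡0 u≢v (¬-not cross) u∉S v∉S

alternating : ∀ n → Subset n
alternating zero          = []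
alternating (suc zero)    = inside ∷ []
alternating (suc (suc n)) = inside ∷ outside ∷ alternating n

alternating-classes : ∀ m n → m + m ≤ n → ∀ c → m ≤ ∣ colourClass (alternating n) c ∣
alternating-classes zero    n _  _ = z≤n
alternating-classes (suc m) n le rewrite +-suc m m = step n le
  where
  step : ∀ n → 2 + (m + m) ≤ n → ∀ c → suc m ≤ ∣ colourClass (alternating n) c ∣
  step (suc (suc n)) (s≤s (s≤s le)) true  = s≤s (alternating-classes m n le true)
  step (suc (suc n)) (s≤s (s≤s le)) false = s≤s (alternating-classes m n le false)

proposition4p1 : (k n : ℕ) → 1 ≤ k → 2 * k + 4 ≤ n → IsCanceling k (K n)
proposition4p1 k n k≥1 n≥2k+4 =
  σ , (λ i j _ → signingBy-sym C i j) ,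
  λ S ∣S∣<k → dist≡0⇒wiener≡0 (K n) σ S (signingBy-dist≡0 C S n≥5 (classes-survive S ∣S∣<k))
  where
  open +-*-Solver
  C : Subset n
  C = alternating n
  σ : Fin n → Fin n → Sign
  σ = signingBy C

  n≥5 : 5 ≤ n
  n≥5 = ≤-trans (+-monoˡ-≤ 4 (≤-trans k≥1 (m≤m+n k (k + 0)))) n≥2k+4

  classes-large : ∀ c → k + 2 ≤ ∣ colourClass C c ∣
  classes-large = alternating-classes (k + 2) n (subst (_≤ n) (sym twice) n≥2k+4)
    where
    twice : (k + 2) + (k + 2) ≡ 2 * k + 4
    twice = solve 1 (λ k → (k :+ con 2) :+ (k :+ con 2) := con 2 :* k :+ con 4) refl k

  classes-survive : ∀ S → ∣ S ∣ < k → ∀ c → 3 + ∣ S ∣ ≤ ∣ colourClass C c ∣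
  classes-survive S ∣S∣<k c =
    ≤-trans (subst (_≤ k + 2) (+-comm (suc ∣ S ∣) 2) (+-monoˡ-≤ 2 ∣S∣<k)) (classes-large c)
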